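{- Let $a,b$ be coprime positive integers with $a>1$, and define $f\colon \mathbb{Z}^+\to\mathbb{Z}^+$ by $f(z)=az+b$. Let $z>1$ be an integer coprime with $a$. Then not all of the numbers $f(z),f^2(z),f^3(z),\dots$ are prime, and the length $\ell(z)$ of the rooted Cunningham chain with root $z$ satisfies $\ell(z)<z$.
   Context: $f^n$ denotes the $n$-fold iterate of $f$. For a positive integer $z$, the rooted Cunningham chain with root $z$ is the list $\{f(z),f^2(z),\dots,f^{\ell(z)}(z)\}$ where all listed elements are prime and $f^{\ell(z)+1}(z)$ is composite; i.e. $\ell(z)\ge 0$ is the number of consecutive terms $f(z),f^2(z),\dots$ that are prime before the first composite term. Note $z$ itself is not part of the list and need not be prime. -}

module Defs where

open import Data.Nat using (ℕ; zero; suc; _+_; _*_)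
open import Data.Nat.Primality using (Prime)
open import Data.Product using (_×_)
open import Relation.Nullary using (¬_)

aff : ℕ → ℕ → ℕ → ℕ
aff a b z = a * z + b

iter : (ℕ → ℕ) → ℕ → ℕ → ℕ
iter f zero    z = z
iter f (suc n) z = f (iter f n z)

IsChainLength : (ℕ → ℕ) → ℕ → ℕ → Set
IsChainLength f z ℓ =
  (∀ i → 1 Data.Nat.≤ i → i Data.Nat.≤ ℓ → Prime (iter f i z)) × ¬ Prime (iter f (suc ℓ) z)

-- Among the z + 1 residues of z, f(z), …, f^z(z) modulo z two coincide, and
-- since a is invertible modulo z, cancelling the common iterates shows
-- f^n(z) ≡ z ≡ 0 (mod z) for some 1 ≤ n ≤ z. As f is strictly increasing,
-- f^n(z) > z > 1, so z is a proper divisor of f^n(z) and the chain breaks at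
-- the latest at step n.
module Submission where

open import Defs
open import Data.Nat
  using (ℕ; zero; suc; _+_; _*_; _∸_; _<_; _≤_; NonZero; _%_; _/_; >-nonZero; n>1⇒nonTrivial; z<s)
open import Data.Nat.Properties
open import Data.Nat.DivMod using (m≡m%n+[m/n]*n; m%n<n)
open import Data.Nat.Divisibility
  using (_∣_; divides; ∣-refl; ∣m∸n∣n⇒∣m; hasNonTrivialDivisor)
open import Data.Nat.Coprimality using (Coprime; coprime-divisor)
open import Data.Nat.Primality using (Prime; prime?; composite⇒¬prime)
open import Data.Fin using (Fin; toℕ; fromℕ<)
open import Data.Fin.Properties using (pigeonhole; toℕ-fromℕ<; toℕ<n)
open import Data.Product using (∃; _×_; _,_)
open import Data.Sum using (_⊎_; inj₁; inj₂)
open import Data.Empty using (⊥-elim)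
open import Function using (_∘_)
open import Relation.Nullary using (¬_; yes; no)
open import Relation.Unary using (Decidable)
open import Relation.Binary.PropositionalEquality

iter-+ : ∀ (f : ℕ → ℕ) m n x → iter f (m + n) x ≡ iter f m (iter f n x)
iter-+ f zero    n x = refl
iter-+ f (suc m) n x = cong f (iter-+ f m n x)

iter-inflationary : ∀ (f : ℕ → ℕ) → (∀ x → x < f x) → ∀ k x → x < iter f (suc k) x
iter-inflationary f inf zero    x = inf x
iter-inflationary f inf (suc k) x = <-trans (iter-inflationary f inf k x) (inf _)

aff-inflationary : ∀ {a b} → 1 ≤ a → 1 ≤ b → ∀ x → x < aff a b x
aff-inflationary {a} {b} 1≤a 1≤b x = begin-strict
  x         <⟨ n<1+n x ⟩
  suc x     ≡⟨ +-comm 1 x ⟩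
  x + 1     ≤⟨ +-mono-≤ (m≤n*m x a {{>-nonZero 1≤a}}) 1≤b ⟩
  a * x + b ∎
  where open ≤-Reasoning

-- With truncated subtraction, d ∣ x ∸ y expresses x ≡ y (mod d) only when
-- y ≤ x (it is trivial otherwise); that suffices, since f^n(z) ≥ z.
%≡⇒∣∸ : ∀ {d} .{{_ : NonZero d}} x y → x % d ≡ y % d → d ∣ x ∸ y
%≡⇒∣∸ {d} x y x%d≡y%d = divides (x / d ∸ y / d) (begin
  x ∸ y                                     ≡⟨ cong₂ _∸_ (m≡m%n+[m/n]*n x d) (m≡m%n+[m/n]*n y d) ⟩
  (x % d + x / d * d) ∸ (y % d + y / d * d) ≡⟨ cong (λ r → (x % d + x / d * d) ∸ (r + y / d * d)) x%d≡y%d ⟨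
  (x % d + x / d * d) ∸ (x % d + y / d * d) ≡⟨ [m+n]∸[m+o]≡n∸o (x % d) _ _ ⟩
  x / d * d ∸ y / d * d                     ≡⟨ *-distribʳ-∸ d (x / d) (y / d) ⟨
  (x / d ∸ y / d) * d                       ∎)
  where open ≡-Reasoning

aff-∣∸-cancel : ∀ {d a b} → Coprime d a → ∀ x y → d ∣ aff a b x ∸ aff a b y → d ∣ x ∸ y
aff-∣∸-cancel {d} {a} {b} d⊥a x y d∣fx∸fy = coprime-divisor d⊥a (subst (d ∣_) fx∸fy≡a[x∸y] d∣fx∸fy)
  where
  open ≡-Reasoning
  fx∸fy≡a[x∸y] : aff a b x ∸ aff a b y ≡ a * (x ∸ y)
  fx∸fy≡a[x∸y] = begin
    (a * x + b) ∸ (a * y + b) ≡⟨ cong₂ _∸_ (+-comm (a * x) b) (+-comm (a * y) b) ⟩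
    (b + a * x) ∸ (b + a * y) ≡⟨ [m+n]∸[m+o]≡n∸o b (a * x) (a * y) ⟩
    a * x ∸ a * y             ≡⟨ *-distribˡ-∸ a x y ⟨
    a * (x ∸ y)               ∎

iter-aff-∣∸-cancel : ∀ {d a b} → Coprime d a → ∀ i x y →
  d ∣ iter (aff a b) i x ∸ iter (aff a b) i y → d ∣ x ∸ y
iter-aff-∣∸-cancel d⊥a zero    x y d∣ = d∣
iter-aff-∣∸-cancel d⊥a (suc i) x y d∣ =
  iter-aff-∣∸-cancel d⊥a i x y (aff-∣∸-cancel d⊥a _ _ d∣)

residue : ∀ d .{{_ : NonZero d}} → ℕ → Fin d
residue d x = fromℕ< (m%n<n x d)

residues-collide : ∀ d .{{_ : NonZero d}} (s : ℕ → ℕ) →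
  ∃ λ i → ∃ λ j → i < j × j ≤ d × s i % d ≡ s j % d
residues-collide d s with i , j , i<j , residueᵢ≡residueⱼ ← pigeonhole (n<1+n d) (residue d ∘ s ∘ toℕ)
  = toℕ i , toℕ j , i<j , ≤-pred (toℕ<n j) , (begin
    s (toℕ i) % d               ≡⟨ toℕ-fromℕ< _ ⟨
    toℕ (residue d (s (toℕ i))) ≡⟨ cong toℕ residueᵢ≡residueⱼ ⟩
    toℕ (residue d (s (toℕ j))) ≡⟨ toℕ-fromℕ< _ ⟩
    s (toℕ j) % d               ∎)
  where open ≡-Reasoning

aff-orbit-returns : ∀ {a b} d .{{_ : NonZero d}} → Coprime d a → ∀ x →
  ∃ λ n → 1 ≤ n × n ≤ d × d ∣ iter (aff a b) n x ∸ x
aff-orbit-returns {a} {b} d d⊥a x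
  with i , j , i<j , j≤d , fⁱx%d≡fʲx%d ← residues-collide d (λ k → iter (aff a b) k x)
  = j ∸ i , m<n⇒0<n∸m i<j , ≤-trans (m∸n≤m j i) j≤d
  , iter-aff-∣∸-cancel d⊥a i _ _ (%≡⇒∣∸ _ _ (sym fⁱx%d≡fⁱ[fʲ⁻ⁱx]%d))
  where
  open ≡-Reasoning
  f = aff a b
  fⁱx%d≡fⁱ[fʲ⁻ⁱx]%d : iter f i x % d ≡ iter f i (iter f (j ∸ i) x) % d
  fⁱx%d≡fⁱ[fʲ⁻ⁱx]%d = begin
    iter f i x % d                  ≡⟨ fⁱx%d≡fʲx%d ⟩
    iter f j x % d                  ≡⟨ cong (λ k → iter f k x % d) (m+[n∸m]≡n (<⇒≤ i<j)) ⟨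
    iter f (i + (j ∸ i)) x % d      ≡⟨ cong (_% d) (iter-+ f i (j ∸ i) x) ⟩
    iter f i (iter f (j ∸ i) x) % d ∎

HoldsUpTo : (ℕ → Set) → ℕ → Set
HoldsUpTo Q n = ∀ i → 1 ≤ i → i ≤ n → Q i

module _ (Q : ℕ → Set) (Q? : Decidable Q) where

  holdsUpTo-or-failsBefore : ∀ n → HoldsUpTo Q n ⊎ ∃ λ ℓ → (HoldsUpTo Q ℓ × ¬ Q (suc ℓ)) × ℓ < n
  holdsUpTo-or-failsBefore zero = inj₁ λ i 1≤i i≤0 → ⊥-elim (<⇒≱ 1≤i i≤0)
  holdsUpTo-or-failsBefore (suc n) with holdsUpTo-or-failsBefore n | Q? (suc n)
  ... | inj₂ (ℓ , failure , ℓ<n) | _     = inj₂ (ℓ , failure , m<n⇒m<1+n ℓ<n)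
  ... | inj₁ upToN               | no ¬q = inj₂ (n , (upToN , ¬q) , n<1+n n)
  ... | inj₁ upToN               | yes q = inj₁ upToSucN
    where
    upToSucN : HoldsUpTo Q (suc n)
    upToSucN i 1≤i i≤1+n with m≤n⇒m<n∨m≡n i≤1+n
    ... | inj₁ i<1+n = upToN i 1≤i (≤-pred i<1+n)
    ... | inj₂ refl  = q

  first-failure : ∀ n → 1 ≤ n → ¬ Q n → ∃ λ ℓ → (HoldsUpTo Q ℓ × ¬ Q (suc ℓ)) × ℓ < n
  first-failure n 1≤n ¬qn with holdsUpTo-or-failsBefore n
  ... | inj₁ upToN   = ⊥-elim (¬qn (upToN n 1≤n ≤-refl))
  ... | inj₂ failure = failure

¬prime-of-proper-divisor : ∀ {d m} → 1 < d → d < m → d ∣ m → ¬ Prime m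
¬prime-of-proper-divisor 1<d d<m d∣m =
  composite⇒¬prime (hasNonTrivialDivisor {{n>1⇒nonTrivial 1<d}} d<m d∣m)

inflationary-iter-¬prime : ∀ (f : ℕ → ℕ) → (∀ x → x < f x) → ∀ {z} → 1 < z → ∀ k →
  z ∣ iter f (suc k) z ∸ z → ¬ Prime (iter f (suc k) z)
inflationary-iter-¬prime f inf {z} 1<z k z∣fⁿz∸z =
  ¬prime-of-proper-divisor 1<z z<fⁿz (∣m∸n∣n⇒∣m z (<⇒≤ z<fⁿz) z∣fⁿz∸z ∣-refl)
  where
  z<fⁿz : z < iter f (suc k) z
  z<fⁿz = iter-inflationary f inf k z

chainLength-below : ∀ (f : ℕ → ℕ) z n → 1 ≤ n → ¬ Prime (iter f n z) →
  ∃ λ ℓ → IsChainLength f z ℓ × ℓ < n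
chainLength-below f z = first-failure (λ i → Prime (iter f i z)) (λ i → prime? (iter f i z))

theorem1 : (a b z : ℕ) → 1 < a → 1 ≤ b → Coprime a b → 1 < z → Coprime z a →
    (∃ λ n → 1 ≤ n × ¬ Prime (iter (aff a b) n z))
    × (∃ λ ℓ → IsChainLength (aff a b) z ℓ × ℓ < z)
theorem1 a b z 1<a 1≤b _ 1<z z⊥a
  with n@(suc k) , 1≤n , n≤z , z∣fⁿz∸z ← aff-orbit-returns {b = b} z {{>-nonZero (<-trans z<s 1<z)}} z⊥a z
  with ¬prime-fⁿz ← inflationary-iter-¬prime (aff a b) (aff-inflationary (<⇒≤ 1<a) 1≤b) 1<z k z∣fⁿz∸z
  with ℓ , chain , ℓ<n ← chainLength-below (aff a b) z n 1≤n ¬prime-fⁿz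
  = (n , 1≤n , ¬prime-fⁿz) , (ℓ , chain , <-≤-trans ℓ<n n≤z)
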